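{- Let $t\ge k\ge 2$ be integers and $\gamma>0$. There is $n_0$ such that for every $n\ge n_0$, every $n$-vertex $k$-graph $H$ with \[ \delta(H)\ge \left(1-\frac{1}{\binom{t-1}{k-1}+\binom{t-2}{k-2}}+\gamma\right)n \] contains a $t$-vertex $k$-uniform clique.
   Context: A $k$-graph is a hypergraph all of whose edges have exactly $k$ vertices; $\delta(H)$ is the minimum over all $(k-1)$-sets $S\subseteq V(H)$ of the number of edges containing $S$. A $t$-vertex $k$-uniform clique in $H$ is a set of $t$ vertices all of whose $k$-subsets are edges of $H$. -}

module Defs where

open import Data.Nat as ℕ using (ℕ; zero; suc; _∸_)
open import Data.Nat.Combinatorics using (_C_)
open import Data.Bool using (Bool; true; false; if_then_else_; _∧_; not)
open import Data.Fin using (Fin)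
open import Data.Fin.Subset using (Subset; ∣_∣; _⊆_; _∪_; ⁅_⁆; inside; outside)
open import Data.Vec using (lookup)
open import Data.List using (List; map; allFin)
open import Data.Nat.ListAction using (sum)
open import Data.Integer using (+_)
open import Data.Rational as ℚ using (ℚ)
open import Relation.Binary.PropositionalEquality using (_≡_)

record KGraph (k n : ℕ) : Set where
  field
    edge    : Subset n → Bool
    uniform : ∀ (e : Subset n) → edge e ≡ true → ∣ e ∣ ≡ k
open KGraph public

_∈ᵇ_ : ∀ {n} → Fin n → Subset n → Bool
v ∈ᵇ S = lookup S v

-- codegree of S: number of edges containing S, when ∣ S ∣ = k - 1
-- (such edges are exactly S ∪ {v} for v ∉ S).
codeg : ∀ {k n} → KGraph k n → Subset n → ℕ
codeg {n = n} H S =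
  sum (map (λ v → if not (v ∈ᵇ S) ∧ edge H (⁅ v ⁆ ∪ S) then 1 else 0) (allFin n))

MinCodegAtLeast : ∀ {k n} → KGraph k n → ℚ → Set
MinCodegAtLeast {k} {n} H d =
  ∀ (S : Subset n) → ∣ S ∣ ≡ k ∸ 1 → d ℚ.≤ (+ codeg H S) ℚ./ 1

HasClique : ∀ {k n} → KGraph k n → ℕ → Set
HasClique {k} {n} H t =
  Data.Product.Σ (Subset n) λ T →
    (∣ T ∣ ≡ t) Data.Product.× (∀ (S : Subset n) → S ⊆ T → ∣ S ∣ ≡ k → edge H S ≡ true)
  where import Data.Product

-- 1/m as a rational (m = 0 ↦ 0; only used with m ≥ 1)
inv : ℕ → ℚ
inv zero    = ℚ.0ℚ
inv (suc m) = (+ 1) ℚ./ suc m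

Dtk : ℕ → ℕ → ℕ
Dtk t k = ((t ∸ 1) C (k ∸ 1)) ℕ.+ ((t ∸ 2) C (k ∸ 2))

threshold : ℕ → ℕ → ℚ → ℕ → ℚ
threshold t k γ n = ((ℚ.1ℚ ℚ.- inv (Dtk t k)) ℚ.+ γ) ℚ.* ((+ n) ℚ./ 1)

module Submission where

-- Put D = C(t-1,k-1) + C(t-2,k-2). Since γ > 0, every (k-1)-set S has codegree at
-- least (1 - 1/D) n, so at most n/D vertices fail to form an edge with S. Grow a clique T one
-- vertex at a time: while ∣T∣ < t, T has at most C(t-1,k-1) ≤ D - 1 subsets of size k-1, so T
-- and the vertices failing one of them number at most ∣T∣ + (D-1) n/D < n once n ≥ D t, and
-- any other vertex extends T to a larger clique.

open import Defs
open import Data.Nat as ℕ using (ℕ; zero; suc; _+_; _*_; _∸_; _≤_; z≤n; s≤s)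
open import Data.Nat.Properties
open import Data.Nat.Combinatorics using (_C_; nCk+nC[k+1]≡[n+1]C[k+1])
open import Data.Nat.ListAction using (sum)
open import Data.Integer as ℤ using (+_)
import Data.Integer.Properties as ℤ
open import Data.Rational as ℚ using (ℚ; 0ℚ; 1ℚ; _<_; toℚᵘ)
import Data.Rational.Properties as ℚ
open import Data.Rational.Unnormalised as ℚᵘ using (mkℚᵘ; *≤*)
import Data.Rational.Unnormalised.Properties as ℚᵘ
open import Data.Bool using (Bool; true; false; _∧_; not; if_then_else_)
open import Data.Bool.Properties using (∧-conicalʳ)
open import Data.Fin using (Fin)
open import Data.Fin.Subset
open import Data.Fin.Subset.Properties
open import Data.Vec using ([]; _∷_; here; there; tabulate)
open import Data.Vec.Properties using ([]=⇒lookup; lookup∘tabulate)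
open import Data.List as List using (List; []; _∷_; map; _++_; length; allFin)
open import Data.List.Properties using (length-map; length-++; map-tabulate)
open import Data.List.Membership.Propositional using () renaming (_∈_ to _∈ᴸ_)
open import Data.List.Membership.Propositional.Properties using (∈-map⁺; ∈-map⁻; ∈-++⁺ˡ; ∈-++⁺ʳ; ∈-++⁻)
open import Data.List.Relation.Unary.Any as Any using ()
open import Data.Product using (Σ; ∃; _×_; _,_)
open import Data.Sum using (inj₁; inj₂)
open import Function using (_∘_)
open import Relation.Nullary using (yes; no; contradiction)
open import Relation.Binary.PropositionalEquality

0<nCk : ∀ {n k} → k ≤ n → 0 ℕ.< n C k
0<nCk {k = zero}  _         = s≤s z≤n
0<nCk {suc n} {suc k} (s≤s k≤n) =
  subst (0 ℕ.<_) (nCk+nC[k+1]≡[n+1]C[k+1] n k) (≤-trans (0<nCk k≤n) (m≤m+n _ _))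

nCk≤[1+n]Ck : ∀ n k → n C k ≤ suc n C k
nCk≤[1+n]Ck n zero    = ≤-refl
nCk≤[1+n]Ck n (suc k) = subst (n C suc k ≤_) (nCk+nC[k+1]≡[n+1]C[k+1] n k) (m≤n+m _ _)

C-monoˡ-≤ : ∀ {m n} k → m ≤ n → m C k ≤ n C k
C-monoˡ-≤ k m≤n with ≤⇒≤′ m≤n
... | ℕ.≤′-refl = ≤-refl
... | ℕ.≤′-step {n = n′} m≤′n′ = ≤-trans (C-monoˡ-≤ k (≤′⇒≤ m≤′n′)) (nCk≤[1+n]Ck n′ k)

∣p∣≡0⇒p≡⊥ : ∀ {n} (p : Subset n) → ∣ p ∣ ≡ 0 → p ≡ ⊥
∣p∣≡0⇒p≡⊥ []            _     = refl
∣p∣≡0⇒p≡⊥ (outside ∷ p) ∣p∣≡0 = cong (outside ∷_) (∣p∣≡0⇒p≡⊥ p ∣p∣≡0)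

∣p∪q∣≤∣p∣+∣q∣ : ∀ {n} (p q : Subset n) → ∣ p ∪ q ∣ ≤ ∣ p ∣ + ∣ q ∣
∣p∪q∣≤∣p∣+∣q∣ []            []            = z≤n
∣p∪q∣≤∣p∣+∣q∣ (inside  ∷ p) (s ∷ q)       =
  s≤s (≤-trans (∣p∪q∣≤∣p∣+∣q∣ p q) (+-monoʳ-≤ ∣ p ∣ (∣p∣≤∣x∷p∣ s q)))
∣p∪q∣≤∣p∣+∣q∣ (outside ∷ p) (outside ∷ q) = ∣p∪q∣≤∣p∣+∣q∣ p q
∣p∪q∣≤∣p∣+∣q∣ (outside ∷ p) (inside  ∷ q) =
  subst (∣ p ∪ q ∣ ℕ.<_) (sym (+-suc ∣ p ∣ ∣ q ∣)) (s≤s (∣p∪q∣≤∣p∣+∣q∣ p q))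

∣⋃map∣≤sum : ∀ {a} {A : Set a} {n} (f : A → Subset n) xs →
  ∣ ⋃ (map f xs) ∣ ≤ sum (map (∣_∣ ∘ f) xs)
∣⋃map∣≤sum {n = n} f []       = ≤-reflexive (∣⊥∣≡0 n)
∣⋃map∣≤sum         f (x ∷ xs) =
  ≤-trans (∣p∪q∣≤∣p∣+∣q∣ (f x) (⋃ (map f xs))) (+-monoʳ-≤ ∣ f x ∣ (∣⋃map∣≤sum f xs))

x∉⋃map⇒x∉ : ∀ {a} {A : Set a} {n} {f : A → Subset n} {x : Fin n} {y xs} →
  x ∉ ⋃ (map f xs) → y ∈ᴸ xs → x ∉ f y
x∉⋃map⇒x∉ {f = f} {xs = y ∷ xs} x∉ (Any.here refl) = x∉ ∘ p⊆p∪q (⋃ (map f xs))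
x∉⋃map⇒x∉ {f = f} {xs = y ∷ xs} x∉ (Any.there y∈) = x∉⋃map⇒x∉ (x∉ ∘ q⊆p∪q (f y) _) y∈

∣p∣<n⇒∃∉ : ∀ {n} (p : Subset n) → ∣ p ∣ ℕ.< n → ∃ λ x → x ∉ p
∣p∣<n⇒∃∉ {n} p ∣p∣<n with nonempty? (∁ p)
... | yes (x , x∈∁p) = x , x∈∁p⇒x∉p x∈∁p
... | no  ∁p-empty   = contradiction ∣∁p∣≡0 (>⇒≢ 0<∣∁p∣)
  where
  ∣∁p∣≡0 : ∣ ∁ p ∣ ≡ 0
  ∣∁p∣≡0 = trans (cong ∣_∣ (Empty-unique ∁p-empty)) (∣⊥∣≡0 n)
  0<∣∁p∣ : 0 ℕ.< ∣ ∁ p ∣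
  0<∣∁p∣ = subst (0 ℕ.<_) (sym (∣∁p∣≡n∸∣p∣ p)) (m<n⇒0<n∸m ∣p∣<n)

x∉p⇒∣⁅x⁆∪p∣≡1+∣p∣ : ∀ {n} {x : Fin n} {p} → x ∉ p → ∣ ⁅ x ⁆ ∪ p ∣ ≡ suc ∣ p ∣
x∉p⇒∣⁅x⁆∪p∣≡1+∣p∣ {x = Fin.zero}  {inside  ∷ p} x∉p = contradiction here x∉p
x∉p⇒∣⁅x⁆∪p∣≡1+∣p∣ {x = Fin.zero}  {outside ∷ p} x∉p = cong (suc ∘ ∣_∣) (∪-identityˡ p)
x∉p⇒∣⁅x⁆∪p∣≡1+∣p∣ {x = Fin.suc x} {inside  ∷ p} x∉p = cong suc (x∉p⇒∣⁅x⁆∪p∣≡1+∣p∣ (x∉p ∘ there))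
x∉p⇒∣⁅x⁆∪p∣≡1+∣p∣ {x = Fin.suc x} {outside ∷ p} x∉p = x∉p⇒∣⁅x⁆∪p∣≡1+∣p∣ (x∉p ∘ there)

x∈p⇒⁅x⁆∪p-x≡p : ∀ {n} {x : Fin n} {p} → x ∈ p → ⁅ x ⁆ ∪ (p - x) ≡ p
x∈p⇒⁅x⁆∪p-x≡p {p = inside ∷ p} here = cong (inside ∷_) (trans (∪-identityˡ (p ─ ⊥)) (p─⊥≡p p))
x∈p⇒⁅x⁆∪p-x≡p {p = s ∷ p} (there x∈p) = cong (s ∷_) (x∈p⇒⁅x⁆∪p-x≡p x∈p)

x∉p-x : ∀ {n} (x : Fin n) p → x ∉ p - x
x∉p-x Fin.zero    (s ∷ p) ()
x∉p-x (Fin.suc x) (s ∷ p) (there x∈p-x) = x∉p-x x p x∈p-x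

p⊆⁅x⁆∪q⇒p-x⊆q : ∀ {n} {x : Fin n} {p q} → p ⊆ ⁅ x ⁆ ∪ q → p - x ⊆ q
p⊆⁅x⁆∪q⇒p-x⊆q {x = x} {p} {q} p⊆ {y} y∈p-x with x∈p∪q⁻ ⁅ x ⁆ q (p⊆ (p─q⊆p p ⁅ x ⁆ y∈p-x))
... | inj₂ y∈q = y∈q
... | inj₁ y∈⁅x⁆ with x∈⁅y⁆⇒x≡y x y∈⁅x⁆
... | refl = contradiction y∈p-x (x∉p-x x p)

p⊆⁅x⁆∪q∧x∉p⇒p⊆q : ∀ {n} {x : Fin n} {p q} → p ⊆ ⁅ x ⁆ ∪ q → x ∉ p → p ⊆ q
p⊆⁅x⁆∪q∧x∉p⇒p⊆q {x = x} {p} {q} p⊆ x∉p {y} y∈p with x∈p∪q⁻ ⁅ x ⁆ q (p⊆ y∈p)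
... | inj₂ y∈q = y∈q
... | inj₁ y∈⁅x⁆ with x∈⁅y⁆⇒x≡y x y∈⁅x⁆
... | refl = contradiction y∈p x∉p

subsetsOfSize : ∀ {n} → ℕ → Subset n → List (Subset n)
subsetsOfSize zero    _             = ⊥ ∷ []
subsetsOfSize (suc m) []            = []
subsetsOfSize (suc m) (outside ∷ p) = map (outside ∷_) (subsetsOfSize (suc m) p)
subsetsOfSize (suc m) (inside  ∷ p) =
  map (inside ∷_) (subsetsOfSize m p) ++ map (outside ∷_) (subsetsOfSize (suc m) p)

length-subsetsOfSize : ∀ {n} m (p : Subset n) → length (subsetsOfSize m p) ≡ ∣ p ∣ C m
length-subsetsOfSize zero    _             = refl
length-subsetsOfSize (suc m) []            = refl
length-subsetsOfSize (suc m) (outside ∷ p) =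
  trans (length-map _ (subsetsOfSize (suc m) p)) (length-subsetsOfSize (suc m) p)
length-subsetsOfSize (suc m) (inside  ∷ p) = begin
  length (map (inside ∷_) (subsetsOfSize m p) ++ map (outside ∷_) (subsetsOfSize (suc m) p))
    ≡⟨ length-++ (map (inside ∷_) (subsetsOfSize m p)) ⟩
  length (map (inside ∷_) (subsetsOfSize m p)) + length (map (outside ∷_) (subsetsOfSize (suc m) p))
    ≡⟨ cong₂ _+_ (length-map _ (subsetsOfSize m p)) (length-map _ (subsetsOfSize (suc m) p)) ⟩
  length (subsetsOfSize m p) + length (subsetsOfSize (suc m) p)
    ≡⟨ cong₂ _+_ (length-subsetsOfSize m p) (length-subsetsOfSize (suc m) p) ⟩
  ∣ p ∣ C m + ∣ p ∣ C suc m
    ≡⟨ nCk+nC[k+1]≡[n+1]C[k+1] ∣ p ∣ m ⟩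
  suc ∣ p ∣ C suc m ∎
  where open ≡-Reasoning

∈-subsetsOfSize⁺ : ∀ {n} m {p q : Subset n} → p ⊆ q → ∣ p ∣ ≡ m → p ∈ᴸ subsetsOfSize m q
∈-subsetsOfSize⁺ zero    {p}                          _   ∣p∣≡0 = Any.here (∣p∣≡0⇒p≡⊥ p ∣p∣≡0)
∈-subsetsOfSize⁺ (suc m) {[]}          {[]}           _   ()
∈-subsetsOfSize⁺ (suc m) {inside  ∷ p} {outside ∷ q}  p⊆q _ with p⊆q here
... | ()
∈-subsetsOfSize⁺ (suc m) {inside  ∷ p} {inside  ∷ q}  p⊆q ∣p∣≡m =
  ∈-++⁺ˡ (∈-map⁺ _ (∈-subsetsOfSize⁺ m (drop-∷-⊆ p⊆q) (suc-injective ∣p∣≡m)))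
∈-subsetsOfSize⁺ (suc m) {outside ∷ p} {outside ∷ q}  p⊆q ∣p∣≡m =
  ∈-map⁺ _ (∈-subsetsOfSize⁺ (suc m) (drop-∷-⊆ p⊆q) ∣p∣≡m)
∈-subsetsOfSize⁺ (suc m) {outside ∷ p} {inside  ∷ q}  p⊆q ∣p∣≡m =
  ∈-++⁺ʳ (map (inside ∷_) (subsetsOfSize m q)) (∈-map⁺ _ (∈-subsetsOfSize⁺ (suc m) (drop-∷-⊆ p⊆q) ∣p∣≡m))

∈-subsetsOfSize⁻ : ∀ {n} m (q : Subset n) {p} → p ∈ᴸ subsetsOfSize m q → ∣ p ∣ ≡ m
∈-subsetsOfSize⁻ {n} zero    _             (Any.here refl) = ∣⊥∣≡0 n
∈-subsetsOfSize⁻     (suc m) (outside ∷ q) p∈ with ∈-map⁻ (outside ∷_) p∈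
... | p′ , p′∈ , refl = ∈-subsetsOfSize⁻ (suc m) q p′∈
∈-subsetsOfSize⁻     (suc m) (inside  ∷ q) p∈ with ∈-++⁻ (map (inside ∷_) (subsetsOfSize m q)) p∈
... | inj₁ p∈₁ with ∈-map⁻ (inside ∷_) p∈₁
...   | p′ , p′∈ , refl = cong suc (∈-subsetsOfSize⁻ m q p′∈)
∈-subsetsOfSize⁻     (suc m) (inside  ∷ q) p∈ | inj₂ p∈₂ with ∈-map⁻ (outside ∷_) p∈₂
...   | p′ , p′∈ , refl = ∈-subsetsOfSize⁻ (suc m) q p′∈

*-sum≤length*n : ∀ {a} {A : Set a} m n (f : A → ℕ) xs →
  (∀ x → x ∈ᴸ xs → m * f x ≤ n) → m * sum (map f xs) ≤ length xs * n
*-sum≤length*n m n f []       _     = ≤-reflexive (*-zeroʳ m)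
*-sum≤length*n m n f (x ∷ xs) bound = begin
  m * (f x + sum (map f xs))     ≡⟨ *-distribˡ-+ m (f x) _ ⟩
  m * f x + m * sum (map f xs)   ≤⟨ +-mono-≤ (bound x (Any.here refl))
                                      (*-sum≤length*n m n f xs (λ y → bound y ∘ Any.there)) ⟩
  n + length xs * n              ∎
  where open ≤-Reasoning

[p+γ]*q≤r⇒p*q≤r : ∀ p q .{{_ : ℚ.NonNegative q}} {γ r} → 0ℚ < γ →
  (p ℚ.+ γ) ℚ.* q ℚ.≤ r → p ℚ.* q ℚ.≤ r
[p+γ]*q≤r⇒p*q≤r p q γ>0 = ℚ.≤-trans (ℚ.*-monoʳ-≤-nonNeg q p≤p+γ)
  where
  p≤p+γ = subst (ℚ._≤ p ℚ.+ _) (ℚ.+-identityʳ p) (ℚ.+-monoʳ-≤ p (ℚ.<⇒≤ γ>0))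

[1-1/[1+d]]*n≤c⇒d*n≤[1+d]*c : ∀ d n c →
  (1ℚ ℚ.- inv (suc d)) ℚ.* (+ n ℚ./ 1) ℚ.≤ + c ℚ./ 1 → d * n ≤ suc d * c
[1-1/[1+d]]*n≤c⇒d*n≤[1+d]*c d n c lhs≤c
  with ℚᵘ.≤-respʳ-≃ (ℚ.toℚᵘ-fromℚᵘ (mkℚᵘ (+ c) 0)) (ℚᵘ.≤-respˡ-≃ toℚᵘ-lhs≃ (ℚ.toℚᵘ-mono-≤ lhs≤c))
  where
  toℚᵘ-lhs≃ : toℚᵘ ((1ℚ ℚ.- inv (suc d)) ℚ.* (+ n ℚ./ 1))
              ℚᵘ.≃ (ℚᵘ.1ℚᵘ ℚᵘ.- mkℚᵘ (+ 1) d) ℚᵘ.* mkℚᵘ (+ n) 0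
  toℚᵘ-lhs≃ = begin
    toℚᵘ ((1ℚ ℚ.- inv (suc d)) ℚ.* (+ n ℚ./ 1))
      ≈⟨ ℚ.toℚᵘ-homo-* (1ℚ ℚ.- inv (suc d)) (+ n ℚ./ 1) ⟩
    toℚᵘ (1ℚ ℚ.- inv (suc d)) ℚᵘ.* toℚᵘ (+ n ℚ./ 1)
      ≈⟨ ℚᵘ.*-cong (ℚ.toℚᵘ-homo-+ 1ℚ (ℚ.- inv (suc d))) (ℚ.toℚᵘ-fromℚᵘ (mkℚᵘ (+ n) 0)) ⟩
    (toℚᵘ 1ℚ ℚᵘ.+ toℚᵘ (ℚ.- inv (suc d))) ℚᵘ.* mkℚᵘ (+ n) 0
      ≈⟨ ℚᵘ.*-congʳ (ℚᵘ.+-congʳ (toℚᵘ 1ℚ) (ℚ.toℚᵘ-homo‿- (inv (suc d)))) ⟩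
    (ℚᵘ.1ℚᵘ ℚᵘ.- toℚᵘ (inv (suc d))) ℚᵘ.* mkℚᵘ (+ n) 0
      ≈⟨ ℚᵘ.*-congʳ (ℚᵘ.+-congʳ ℚᵘ.1ℚᵘ (ℚᵘ.-‿cong (ℚ.toℚᵘ-fromℚᵘ (mkℚᵘ (+ 1) d)))) ⟩
    (ℚᵘ.1ℚᵘ ℚᵘ.- mkℚᵘ (+ 1) d) ℚᵘ.* mkℚᵘ (+ n) 0 ∎
    where open ℚᵘ.≃-Reasoning
... | *≤* num≤num = ℤ.drop‿+≤+ (subst₂ ℤ._≤_ numerator≡ denominator≡ num≤num)
  where
  -- d + 0 and (d + 0) * 1 are what unnormalised subtraction and multiplication compute to.
  numerator≡ : (+ (d + 0) ℤ.* + n) ℤ.* + 1 ≡ + (d * n)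
  numerator≡ = begin
    + (d + 0) ℤ.* + n ℤ.* + 1 ≡⟨ ℤ.*-identityʳ _ ⟩
    + (d + 0) ℤ.* + n         ≡⟨ cong (λ m → + m ℤ.* + n) (+-identityʳ d) ⟩
    + d ℤ.* + n               ≡⟨ ℤ.pos-* d n ⟨
    + (d * n)                 ∎
    where open ≡-Reasoning
  denominator≡ : + c ℤ.* + suc ((d + 0) * 1) ≡ + (suc d * c)
  denominator≡ = begin
    + c ℤ.* + suc ((d + 0) * 1) ≡⟨ ℤ.pos-* c _ ⟨
    + (c * suc ((d + 0) * 1))   ≡⟨ cong (λ m → + (c * suc m)) (trans (*-identityʳ _) (+-identityʳ d)) ⟩
    + (c * suc d)               ≡⟨ cong +_ (*-comm c (suc d)) ⟩
    + (suc d * c)               ∎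
    where open ≡-Reasoning

d*n≤[1+d]*c⇒[1+d]*[n∸c]≤n : ∀ d n c → d * n ≤ suc d * c → suc d * (n ∸ c) ≤ n
d*n≤[1+d]*c⇒[1+d]*[n∸c]≤n d n c d*n≤[1+d]*c = begin
  suc d * (n ∸ c)          ≡⟨ *-distribˡ-∸ (suc d) n c ⟩
  suc d * n ∸ suc d * c    ≤⟨ ∸-monoʳ-≤ (suc d * n) d*n≤[1+d]*c ⟩
  n + d * n ∸ d * n        ≡⟨ m+n∸n≡m n (d * n) ⟩
  n                        ∎
  where open ≤-Reasoning

sum-indicator≡∣tabulate∣ : ∀ {n} (f : Fin n → Bool) →
  sum (map (λ v → if f v then 1 else 0) (allFin n)) ≡ ∣ tabulate f ∣
sum-indicator≡∣tabulate∣ f =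
  trans (cong sum (map-tabulate (λ v → v) (λ v → if f v then 1 else 0))) (sum-tabulate f)
  where
  sum-tabulate : ∀ {m} (g : Fin m → Bool) →
    sum (List.tabulate (λ v → if g v then 1 else 0)) ≡ ∣ tabulate g ∣
  sum-tabulate {zero}  g = refl
  sum-tabulate {suc m} g with g Fin.zero
  ... | true  = cong suc (sum-tabulate (g ∘ Fin.suc))
  ... | false = sum-tabulate (g ∘ Fin.suc)

module _ {k n} (H : KGraph k n) where

  link : Subset n → Subset n
  link S = tabulate λ v → not (v ∈ᵇ S) ∧ edge H (⁅ v ⁆ ∪ S)

  codeg≡∣link∣ : ∀ S → codeg H S ≡ ∣ link S ∣
  codeg≡∣link∣ S = sum-indicator≡∣tabulate∣ λ v → not (v ∈ᵇ S) ∧ edge H (⁅ v ⁆ ∪ S)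

  ∈link⇒edge : ∀ {v S} → v ∈ link S → edge H (⁅ v ⁆ ∪ S) ≡ true
  ∈link⇒edge {v} v∈link =
    ∧-conicalʳ _ _ (trans (sym (lookup∘tabulate _ v)) ([]=⇒lookup v∈link))

  IsClique : Subset n → Set
  IsClique T = ∀ S → S ⊆ T → ∣ S ∣ ≡ k → edge H S ≡ true

module _ {k n} (H : KGraph (suc k) n) where

  ⊥-isClique : IsClique H ⊥
  ⊥-isClique S S⊆⊥ ∣S∣≡1+k = contradiction (subst (_≤ 0) ∣S∣≡1+k ∣S∣≤0) λ ()
    where
    ∣S∣≤0 : ∣ S ∣ ≤ 0
    ∣S∣≤0 = ≤-trans (p⊆q⇒∣p∣≤∣q∣ S⊆⊥) (≤-reflexive (∣⊥∣≡0 n))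

  isClique-⁅v⁆∪ : ∀ {T v} → IsClique H T → (∀ S → S ∈ᴸ subsetsOfSize k T → v ∈ link H S) →
    IsClique H (⁅ v ⁆ ∪ T)
  isClique-⁅v⁆∪ {T} {v} T-clique v-joins S S⊆ ∣S∣≡1+k with v ∈? S
  ... | no  v∉S = T-clique S (p⊆⁅x⁆∪q∧x∉p⇒p⊆q S⊆ v∉S) ∣S∣≡1+k
  ... | yes v∈S =
    subst (λ e → edge H e ≡ true) (x∈p⇒⁅x⁆∪p-x≡p v∈S) (∈link⇒edge H (v-joins (S - v) S-v∈))
    where
    ∣S-v∣≡k : ∣ S - v ∣ ≡ k
    ∣S-v∣≡k = suc-injective (trans (sym (x∉p⇒∣⁅x⁆∪p∣≡1+∣p∣ (x∉p-x v S)))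
                                   (trans (cong ∣_∣ (x∈p⇒⁅x⁆∪p-x≡p v∈S)) ∣S∣≡1+k))
    S-v∈ : S - v ∈ᴸ subsetsOfSize k T
    S-v∈ = ∈-subsetsOfSize⁺ k (p⊆⁅x⁆∪q⇒p-x⊆q S⊆) ∣S-v∣≡k

  module _ {d} (sparse : ∀ S → ∣ S ∣ ≡ k → suc d * ∣ ∁ (link H S) ∣ ≤ n) where

    joinableVertex : ∀ T → ∣ T ∣ C k ≤ d → suc d * suc ∣ T ∣ ≤ n →
      ∃ λ v → v ∉ T × (∀ S → S ∈ᴸ subsetsOfSize k T → v ∈ link H S)
    joinableVertex T ∣T∣Ck≤d room with ∣p∣<n⇒∃∉ blocked ∣blocked∣<n
      where
      Ss = subsetsOfSize k T
      nonLink = ∁ ∘ link H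
      blocked = T ∪ ⋃ (map nonLink Ss)
      i = ∣ T ∣
      missing = sum (map (∣_∣ ∘ nonLink) Ss)
      d+1*missing≤d*n : suc d * missing ≤ d * n
      d+1*missing≤d*n = begin
        suc d * missing  ≤⟨ *-sum≤length*n (suc d) n (∣_∣ ∘ nonLink) Ss
                              (λ S S∈ → sparse S (∈-subsetsOfSize⁻ k T S∈)) ⟩
        length Ss * n    ≡⟨ cong (_* n) (length-subsetsOfSize k T) ⟩
        (i C k) * n      ≤⟨ *-monoˡ-≤ n ∣T∣Ck≤d ⟩
        d * n            ∎
        where open ≤-Reasoning
      ∣blocked∣≤i+missing : ∣ blocked ∣ ≤ i + missing
      ∣blocked∣≤i+missing = ≤-trans (∣p∪q∣≤∣p∣+∣q∣ T _) (+-monoʳ-≤ i (∣⋃map∣≤sum nonLink Ss))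
      ∣blocked∣<n : ∣ blocked ∣ ℕ.< n
      ∣blocked∣<n = *-cancelˡ-< (suc d) _ _ (begin-strict
        suc d * ∣ blocked ∣        ≤⟨ *-monoʳ-≤ (suc d) ∣blocked∣≤i+missing ⟩
        suc d * (i + missing)      ≡⟨ *-distribˡ-+ (suc d) i missing ⟩
        suc d * i + suc d * missing <⟨ +-mono-<-≤ (*-monoʳ-< (suc d) (n<1+n i)) d+1*missing≤d*n ⟩
        suc d * suc i + d * n      ≤⟨ +-monoˡ-≤ (d * n) room ⟩
        n + d * n                  ∎)
        where open ≤-Reasoning
    ... | v , v∉blocked =
      v , v∉blocked ∘ p⊆p∪q _ , λ S S∈ → x∉∁p⇒x∈p (x∉⋃map⇒x∉ (v∉blocked ∘ q⊆p∪q T _) S∈)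

    greedyClique : ∀ t → t C k ≤ d → suc d * suc t ≤ n → HasClique H (suc t)
    greedyClique t tCk≤d room = cliqueOfSize (suc t) ≤-refl
      where
      cliqueOfSize : ∀ i → i ≤ suc t → Σ (Subset n) λ T → ∣ T ∣ ≡ i × IsClique H T
      cliqueOfSize zero    _         = ⊥ , ∣⊥∣≡0 n , ⊥-isClique
      cliqueOfSize (suc i) (s≤s i≤t) with cliqueOfSize i (m≤n⇒m≤1+n i≤t)
      ... | T , refl , T-clique with joinableVertex T (≤-trans (C-monoˡ-≤ k i≤t) tCk≤d)
                                                     (≤-trans (*-monoʳ-≤ (suc d) (s≤s i≤t)) room)
      ... | v , v∉T , v-joins = ⁅ v ⁆ ∪ T , x∉p⇒∣⁅x⁆∪p∣≡1+∣p∣ v∉T , isClique-⁅v⁆∪ T-clique v-joins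

cliqueAboveThreshold : ∀ {k n} t D → t C k ℕ.< D → D * suc t ≤ n → ∀ {γ} → 0ℚ < γ →
  (H : KGraph (suc k) n) → MinCodegAtLeast H (((1ℚ ℚ.- inv D) ℚ.+ γ) ℚ.* (+ n ℚ./ 1)) →
  HasClique H (suc t)
cliqueAboveThreshold {k} {n} t (suc d) (s≤s tCk≤d) room γ>0 H δH≥ =
  greedyClique H sparse t tCk≤d room
  where
  sparse : ∀ S → ∣ S ∣ ≡ k → suc d * ∣ ∁ (link H S) ∣ ≤ n
  sparse S ∣S∣≡k = subst (λ m → suc d * m ≤ n) (sym ∣∁link∣≡n∸codeg)
                     (d*n≤[1+d]*c⇒[1+d]*[n∸c]≤n d n (codeg H S) d*n≤[1+d]*codeg)
    where
    ∣∁link∣≡n∸codeg : ∣ ∁ (link H S) ∣ ≡ n ∸ codeg H S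
    ∣∁link∣≡n∸codeg = trans (∣∁p∣≡n∸∣p∣ (link H S)) (cong (n ∸_) (sym (codeg≡∣link∣ H S)))
    d*n≤[1+d]*codeg : d * n ≤ suc d * codeg H S
    d*n≤[1+d]*codeg = [1-1/[1+d]]*n≤c⇒d*n≤[1+d]*c d n (codeg H S)
      ([p+γ]*q≤r⇒p*q≤r (1ℚ ℚ.- inv (suc d)) (+ n ℚ./ 1) {{ℚ.normalize-nonNeg n 1}} γ>0 (δH≥ S ∣S∣≡k))

proposition2p6 : ∀ (t k : ℕ) → 2 ≤ k → k ≤ t → ∀ (γ : ℚ) → 0ℚ < γ →
    Σ ℕ λ n₀ → ∀ (n : ℕ) → n₀ ≤ n → ∀ (H : KGraph k n) →
      MinCodegAtLeast H (threshold t k γ n) → HasClique H t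
proposition2p6 (suc (suc t)) (suc (suc k)) (s≤s (s≤s z≤n)) (s≤s (s≤s k≤t)) γ γ>0 =
  D * suc (suc t) , λ n n₀≤n → cliqueAboveThreshold (suc t) D [1+t]C[1+k]<D n₀≤n γ>0
  where
  D = Dtk (suc (suc t)) (suc (suc k))
  [1+t]C[1+k]<D : suc t C suc k ℕ.< D
  [1+t]C[1+k]<D = m<m+n (suc t C suc k) (0<nCk k≤t)
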